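{- Let $\Gamma$ be a maximal $\mathsf{MLSR}$-consistent set that is named, $\Diamond$-pasted, $\mathsf{E}$-pasted, mixed and $\mathsf{E}$-mixed, and let $\mathcal{M}$ be the upper Henkin model generated by $\Gamma$. Then for all formulas $\psi$, all finite sequences of formulas $\overline{\varphi}=(\varphi_1,\dots,\varphi_k)$ and all points $(w,\overline{\varphi})$ of the derived Henkin model $\mathcal{M}:\overline{\varphi}$: $\mathcal{M}:\overline{\varphi},(w,\overline{\varphi})\models\psi$ iff $\psi\in\Phi(\mathcal{M},\overline{\varphi},w)$.
   Context: Formulas: $\varphi ::= p\mid \mathsf{n}\mid\top\mid\neg\varphi\mid(\varphi\vee\varphi)\mid\Diamond\varphi\mid\langle!\varphi\rangle\varphi\mid\langle-\varphi\rangle\varphi\mid\mathsf{E}\varphi$ ($p$ proposition letters, $\mathsf{n}$ nominals); duals $\Box,[!\varphi],[-\varphi],\mathsf{U}$. Proof system $\mathsf{MLSR}$: replacement of provable equivalents; propositional tautologies and Modus Ponens; K axiom and necessitation for $\Box,\mathsf{U},[!\varphi],[-\varphi]$; S5 for $\mathsf{U}$ and $\mathsf{U}\varphi\rightarrow\Box\varphi$; $\langle!\varphi\rangle p\leftrightarrow(\varphi\wedge p)$, $\langle!\varphi\rangle\mathsf{n}\leftrightarrow(\varphi\wedge\mathsf{n})$, $\langle!\varphi\rangle\top\leftrightarrow\varphi$, $\langle!\varphi\rangle\neg\psi\leftrightarrow(\varphi\wedge\neg\langle!\varphi\rangle\psi)$, $\langle!\varphi\rangle(\psi\vee\alpha)\leftrightarrow(\langle!\varphi\rangle\psi\vee\langle!\varphi\rangle\alpha)$,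 $\langle!\varphi\rangle\Diamond\psi\leftrightarrow(\varphi\wedge\Diamond\langle!\varphi\rangle\psi)$, $\langle!\varphi\rangle\langle!\psi\rangle\alpha\leftrightarrow\langle!(\varphi\wedge[!\varphi]\psi)\rangle\alpha$, $\langle!\varphi\rangle\mathsf{E}\psi\leftrightarrow(\varphi\wedge\mathsf{E}\langle!\varphi\rangle\psi)$; $\langle!\top\rangle\varphi\leftrightarrow\varphi$; (H) $\mathsf{E}(\mathsf{n}\wedge\varphi)\rightarrow\mathsf{U}(\mathsf{n}\rightarrow\varphi)$; Name rule; Paste rule (for $\nabla\in\{\Diamond,\mathsf{E}\}$); Mix Axiom $(\mathsf{E}(\mathsf{n}\wedge\alpha)\wedge\langle!\neg\mathsf{n}\rangle\varphi)\rightarrow\langle-\alpha\rangle\varphi$; Mix Rule (from $\mathsf{E}(\mathsf{n}\wedge\langle!\varphi\rangle(\mathsf{E}(\mathsf{k}\wedge\alpha)\wedge\langle!\neg\mathsf{k}\rangle\psi))\rightarrow\sigma$ infer $\mathsf{E}(\mathsf{n}\wedge\langle!\varphi\rangle\langle-\alpha\rangle\psi)\rightarrow\sigma$, $\mathsf{k}$ not in $\varphi,\alpha,\psi,\sigma$). Named/pasted/mixed: $\Gamma$ contains a nominal; $\mathsf{E}(\mathsf{n}\wedge\nabla\varphi)\in\Gamma$ ($\nabla\in\{\Diamond,\mathsf{E}\}$) implies $\mathsf{E}(\mathsf{n}\wedge\nabla\mathsf{m})\wedge\mathsf{E}(\mathsf{m}\wedge\varphi)\in\Gamma$ for some nominal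 $\mathsf{m}$; $\langle!\varphi\rangle\langle-\alpha\rangle\psi\in\Gamma$ implies $\langle!\varphi\rangle\mathsf{E}(\mathsf{n}\wedge\alpha)\wedge\langle!\varphi\rangle\langle!\neg\mathsf{n}\rangle\psi\in\Gamma$ for some nominal $\mathsf{n}$; $\mathsf{E}(\mathsf{n}\wedge\langle!\varphi\rangle\langle-\alpha\rangle\psi)\in\Gamma$ implies $\mathsf{E}(\mathsf{n}\wedge\langle!\varphi\rangle(\mathsf{E}(\mathsf{k}\wedge\alpha)\wedge\langle!\neg\mathsf{k}\rangle\psi))\in\Gamma$ for some nominal $\mathsf{k}$. Upper Henkin model $\mathcal{M}=(W,R_\Diamond,R_{\mathsf{E}},V)$: $\Delta_{\mathsf{n}}=\{\varphi:\mathsf{E}(\mathsf{n}\wedge\varphi)\in\Gamma\}$ for $\mathsf{E}\mathsf{n}\in\Gamma$; $\mathcal{W}=\{\Gamma\}\cup\{\Delta_{\mathsf{n}}:\mathsf{E}\mathsf{n}\in\Gamma\}$; $\mathcal{R}_\Diamond(\Delta_{\mathsf{n}},\Delta_{\mathsf{m}})$ iff $\mathsf{E}(\mathsf{n}\wedge\Diamond\mathsf{m})\in\Gamma$; $\mathcal{R}_{\mathsf{E}}(\Delta_{\mathsf{n}},\Delta_{\mathsf{m}})$ iff $\mathsf{E}(\mathsf{n}\wedge\mathsf{E}\mathsf{m})\in\Gamma$ (with $\Gamma=\Delta_{\mathsf{n}}$ for $\mathsf{n}\in\Gamma$); $W$ is the $\mathcal{R}_{\mathsf{E}}$-class of $\Gamma$,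 $R_\Diamond,R_{\mathsf{E}}$ the restrictions; $V(p)=\{w:p\in w\}$; $V(\mathsf{n})=\{\Delta_{\mathsf{n}}\}$ if $\mathsf{E}\mathsf{n}\in\Gamma$, else $\varnothing$. Derived Henkin model $\mathcal{M}:\overline{\varphi}$ for $\overline{\varphi}=(\varphi_1,\dots,\varphi_k)$: domain $W_{\overline{\varphi}}=\{(w,\overline{\varphi}):w\in W,\ \langle!\varphi_1\rangle\cdots\langle!\varphi_k\rangle\top\in w\}$; $R^{\overline{\varphi}}_\Diamond((w,\overline{\varphi}),(v,\overline{\varphi}))$ iff $R_\Diamond wv$, similarly $R^{\overline{\varphi}}_{\mathsf{E}}$; $V^{\overline{\varphi}}(p)=\{(w,\overline{\varphi}):p\in w\}$ and $V^{\overline{\varphi}}(\mathsf{n})=\{(w,\overline{\varphi}):\mathsf{n}\in w\}$ (restricted to the domain). $\Phi(\mathcal{M},\overline{\varphi},w)=\{\alpha:\langle!\varphi_1\rangle\cdots\langle!\varphi_k\rangle\alpha\in w\}$. Truth in such a model $\mathcal{N}$ (domain $D$, relation $R_\Diamond^{\overline{\varphi}}$, valuation $V^{\overline{\varphi}}$): letters and nominals via the valuation, $\top$ always, Booleans standard, $\Diamond$ along $R^{\overline{\varphi}}_\Diamond$, $\mathsf{E}\varphi$ true iff $\varphi$ holds at some point of $D$, $\langle!\varphi\rangle\psi$ true at $s$ iff $\varphi$ holds at $s$ and $\psi$ holds at $s$ in the submodel on the $\varphi$-points, $\langle-\varphi\rangle\psi$ true at $s$ iff some $t\neq s$ in $D$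 satisfies $\varphi$ and $\psi$ holds at $s$ in the submodel on $D\setminus\{t\}$ (submodels restrict relations and valuation). -}

module Defs where

open import Level using (Level; Lift; lift) renaming (suc to lsuc; zero to lzero)
open import Data.Nat using (ℕ)
open import Data.Bool using (Bool; true; false; not; _∨_)
open import Data.List using (List; []; _∷_)
open import Data.List.Relation.Unary.All using (All)
open import Data.Product using (Σ; _×_; _,_; ∃)
open import Data.Sum using (_⊎_)
open import Data.Unit.Polymorphic using (⊤)
open import Relation.Nullary using (¬_)
open import Relation.Binary.PropositionalEquality using (_≡_)

data Form : Set where
  prop : ℕ → Form
  nom  : ℕ → Form
  ⊤'   : Form
  ¬'_  : Form → Form
  _∨'_ : Form → Form → Form
  ◇_   : Form → Form
  ⟨!_⟩_ : Form → Form → Form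
  ⟨-_⟩_ : Form → Form → Form
  E_   : Form → Form

infixr 30 ¬'_ ◇_ E_ □_ U_
infixr 30 ⟨!_⟩_ ⟨-_⟩_ [!_]_ [-_]_
infixl 28 _∧'_
infixl 27 _∨'_
infixr 26 _⇒'_
infix  25 _⇔'_

⊥' : Form
⊥' = ¬' ⊤'

_∧'_ : Form → Form → Form
φ ∧' ψ = ¬' (¬' φ ∨' ¬' ψ)

_⇒'_ : Form → Form → Form
φ ⇒' ψ = ¬' φ ∨' ψ

_⇔'_ : Form → Form → Form
φ ⇔' ψ = (φ ⇒' ψ) ∧' (ψ ⇒' φ)

□_ : Form → Form
□ φ = ¬' (◇ (¬' φ))

U_ : Form → Form
U φ = ¬' (E (¬' φ))

[!_]_ : Form → Form → Form
[! φ ] ψ = ¬' (⟨! φ ⟩ (¬' ψ))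

[-_]_ : Form → Form → Form
[- φ ] ψ = ¬' (⟨- φ ⟩ (¬' ψ))

NomFree : ℕ → Form → Set
NomFree k (prop p)    = ⊤
NomFree k (nom n)     = ¬ (k ≡ n)
NomFree k ⊤'          = ⊤
NomFree k (¬' φ)      = NomFree k φ
NomFree k (φ ∨' ψ)    = NomFree k φ × NomFree k ψ
NomFree k (◇ φ)       = NomFree k φ
NomFree k (⟨! φ ⟩ ψ)  = NomFree k φ × NomFree k ψ
NomFree k (⟨- φ ⟩ ψ)  = NomFree k φ × NomFree k ψ
NomFree k (E φ)       = NomFree k φ

data Ctx : Set where
  hole  : Ctx
  c¬    : Ctx → Ctx
  c∨ˡ   : Ctx → Form → Ctx
  c∨ʳ   : Form → Ctx → Ctx
  c◇    : Ctx → Ctx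
  c!ˡ   : Ctx → Form → Ctx
  c!ʳ   : Form → Ctx → Ctx
  c-ˡ   : Ctx → Form → Ctx
  c-ʳ   : Form → Ctx → Ctx
  cE    : Ctx → Ctx

plug : Ctx → Form → Form
plug hole      α = α
plug (c¬ C)    α = ¬' plug C α
plug (c∨ˡ C ψ) α = plug C α ∨' ψ
plug (c∨ʳ φ C) α = φ ∨' plug C α
plug (c◇ C)    α = ◇ plug C α
plug (c!ˡ C ψ) α = ⟨! plug C α ⟩ ψ
plug (c!ʳ φ C) α = ⟨! φ ⟩ plug C α
plug (c-ˡ C ψ) α = ⟨- plug C α ⟩ ψ
plug (c-ʳ φ C) α = ⟨- φ ⟩ plug C α
plug (cE C)    α = E plug C α

-- Propositional tautologies (and all their substitution instances):
-- non-Boolean subformulas are treated as propositional atoms.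
tv : (Form → Bool) → Form → Bool
tv v ⊤'       = true
tv v (¬' φ)   = not (tv v φ)
tv v (φ ∨' ψ) = tv v φ ∨ tv v ψ
tv v φ        = v φ

Tautology : Form → Set
Tautology φ = (v : Form → Bool) → tv v φ ≡ true

data Nabla : Set where
  ∇◇ ∇E : Nabla

app : Nabla → Form → Form
app ∇◇ φ = ◇ φ
app ∇E φ = E φ

infix 10 ⊢_

data ⊢_ : Form → Set where
  repl   : ∀ {α β} (C : Ctx) → ⊢ α ⇔' β → ⊢ plug C α ⇔' plug C β
  taut   : ∀ {φ} → Tautology φ → ⊢ φ
  mp     : ∀ {φ ψ} → ⊢ φ ⇒' ψ → ⊢ φ → ⊢ ψ
  K□     : ∀ φ ψ → ⊢ □ (φ ⇒' ψ) ⇒' (□ φ ⇒' □ ψ)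
  nec□   : ∀ {φ} → ⊢ φ → ⊢ □ φ
  KU     : ∀ φ ψ → ⊢ U (φ ⇒' ψ) ⇒' (U φ ⇒' U ψ)
  necU   : ∀ {φ} → ⊢ φ → ⊢ U φ
  K!     : ∀ χ φ ψ → ⊢ [! χ ] (φ ⇒' ψ) ⇒' ([! χ ] φ ⇒' [! χ ] ψ)
  nec!   : ∀ χ {φ} → ⊢ φ → ⊢ [! χ ] φ
  K-     : ∀ χ φ ψ → ⊢ [- χ ] (φ ⇒' ψ) ⇒' ([- χ ] φ ⇒' [- χ ] ψ)
  nec-   : ∀ χ {φ} → ⊢ φ → ⊢ [- χ ] φ
  TU     : ∀ φ → ⊢ U φ ⇒' φ
  5U     : ∀ φ → ⊢ E φ ⇒' U (E φ)
  U□     : ∀ φ → ⊢ U φ ⇒' □ φ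
  !p     : ∀ φ p → ⊢ ⟨! φ ⟩ prop p ⇔' (φ ∧' prop p)
  !n     : ∀ φ n → ⊢ ⟨! φ ⟩ nom n ⇔' (φ ∧' nom n)
  !⊤     : ∀ φ → ⊢ ⟨! φ ⟩ ⊤' ⇔' φ
  !¬     : ∀ φ ψ → ⊢ ⟨! φ ⟩ (¬' ψ) ⇔' (φ ∧' ¬' ⟨! φ ⟩ ψ)
  !∨     : ∀ φ ψ α → ⊢ ⟨! φ ⟩ (ψ ∨' α) ⇔' (⟨! φ ⟩ ψ ∨' ⟨! φ ⟩ α)
  !◇     : ∀ φ ψ → ⊢ ⟨! φ ⟩ (◇ ψ) ⇔' (φ ∧' ◇ ⟨! φ ⟩ ψ)
  !!     : ∀ φ ψ α → ⊢ ⟨! φ ⟩ ⟨! ψ ⟩ α ⇔' ⟨! (φ ∧' [! φ ] ψ) ⟩ α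
  !E     : ∀ φ ψ → ⊢ ⟨! φ ⟩ (E ψ) ⇔' (φ ∧' E ⟨! φ ⟩ ψ)
  !⊤ax   : ∀ φ → ⊢ ⟨! ⊤' ⟩ φ ⇔' φ
  H      : ∀ n φ → ⊢ E (nom n ∧' φ) ⇒' U (nom n ⇒' φ)
  name   : ∀ {n φ} → NomFree n φ → ⊢ nom n ⇒' φ → ⊢ φ
  paste  : ∀ (∇ : Nabla) {n m φ ψ} → ¬ (m ≡ n) → NomFree m φ → NomFree m ψ →
           ⊢ (E (nom n ∧' app ∇ (nom m)) ∧' E (nom m ∧' φ)) ⇒' ψ →
           ⊢ E (nom n ∧' app ∇ φ) ⇒' ψ
  mixAx  : ∀ n α φ → ⊢ (E (nom n ∧' α) ∧' ⟨! ¬' nom n ⟩ φ) ⇒' ⟨- α ⟩ φ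
  mixR   : ∀ {n k φ α ψ σ} → ¬ (k ≡ n) →
           NomFree k φ → NomFree k α → NomFree k ψ → NomFree k σ →
           ⊢ E (nom n ∧' ⟨! φ ⟩ (E (nom k ∧' α) ∧' ⟨! ¬' nom k ⟩ ψ)) ⇒' σ →
           ⊢ E (nom n ∧' ⟨! φ ⟩ ⟨- α ⟩ ψ) ⇒' σ

FSet : Set₁
FSet = Form → Set

conj : List Form → Form
conj []       = ⊤'
conj (φ ∷ φs) = φ ∧' conj φs

Consistent : FSet → Set
Consistent Γ = (L : List Form) → All Γ L → ¬ (⊢ ¬' conj L)

MaximalConsistent : FSet → Set
MaximalConsistent Γ = Consistent Γ × ((φ : Form) → Γ φ ⊎ Γ (¬' φ))

Named : FSet → Set
Named Γ = ∃ λ n → Γ (nom n)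

Pasted : Nabla → FSet → Set
Pasted ∇ Γ = ∀ n φ → Γ (E (nom n ∧' app ∇ φ)) →
  ∃ λ m → Γ (E (nom n ∧' app ∇ (nom m)) ∧' E (nom m ∧' φ))

Mixed : FSet → Set
Mixed Γ = ∀ φ α ψ → Γ (⟨! φ ⟩ ⟨- α ⟩ ψ) →
  ∃ λ n → Γ (⟨! φ ⟩ E (nom n ∧' α) ∧' ⟨! φ ⟩ ⟨! ¬' nom n ⟩ ψ)

EMixed : FSet → Set
EMixed Γ = ∀ n φ α ψ → Γ (E (nom n ∧' ⟨! φ ⟩ ⟨- α ⟩ ψ)) →
  ∃ λ k → Γ (E (nom n ∧' ⟨! φ ⟩ (E (nom k ∧' α) ∧' ⟨! ¬' nom k ⟩ ψ)))

record Model : Set₂ where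
  field
    Carrier : Set₁
    _≈_     : Carrier → Carrier → Set    -- identity of points
    Dom     : Carrier → Set
    R◇      : Carrier → Carrier → Set
    RE      : Carrier → Carrier → Set
    Vp      : ℕ → Carrier → Set
    Vn      : ℕ → Carrier → Set

module _ (M : Model) where
  open Model M

  -- sat D s φ : φ holds at s in the submodel of M with domain D
  -- (relations and valuation restricted to D).
  sat : (Carrier → Set₁) → Carrier → Form → Set₁
  sat D s (prop p)   = D s × Lift (lsuc lzero) (Vp p s)
  sat D s (nom n)    = D s × Lift (lsuc lzero) (Vn n s)
  sat D s ⊤'         = ⊤
  sat D s (¬' φ)     = ¬ sat D s φ
  sat D s (φ ∨' ψ)   = sat D s φ ⊎ sat D s ψ
  sat D s (◇ φ)      = Σ Carrier λ t → D t × Lift (lsuc lzero) (R◇ s t) × sat D t φ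
  sat D s (E φ)      = Σ Carrier λ t → D t × sat D t φ
  sat D s (⟨! φ ⟩ ψ) = sat D s φ × sat (λ t → D t × sat D t φ) s ψ
  sat D s (⟨- φ ⟩ ψ) = Σ Carrier λ t → D t × ¬ Lift (lsuc lzero) (t ≈ s) × sat D t φ
                         × sat (λ u → D u × ¬ Lift (lsuc lzero) (u ≈ t)) s ψ

  _,_⊨_ : Carrier → Form → Set₁
  _,_⊨_ s φ = sat (λ t → Lift (lsuc lzero) (Dom t)) s φ

pre : List Form → Form → Form
pre []       α = α
pre (φ ∷ φs) α = ⟨! φ ⟩ pre φs α

_≐_ : FSet → FSet → Set
w ≐ v = (φ : Form) → (w φ → v φ) × (v φ → w φ)

module Henkin (Γ : FSet) where

  Δ : ℕ → FSet
  Δ n φ = Γ (E (nom n ∧' φ))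

  -- w is the point Δ_n  (with the convention Γ = Δ_n for n ∈ Γ)
  IsΔ : ℕ → FSet → Set
  IsΔ n w = (Γ (E (nom n)) × w ≐ Δ n) ⊎ (Γ (nom n) × w ≐ Γ)

  𝒲 : FSet → Set
  𝒲 w = w ≐ Γ ⊎ (∃ λ n → Γ (E (nom n)) × w ≐ Δ n)

  𝓡◇ : FSet → FSet → Set
  𝓡◇ w v = ∃ λ n → ∃ λ m → IsΔ n w × IsΔ m v × Γ (E (nom n ∧' ◇ nom m))

  𝓡E : FSet → FSet → Set
  𝓡E w v = ∃ λ n → ∃ λ m → IsΔ n w × IsΔ m v × Γ (E (nom n ∧' E nom m))

  W : FSet → Set
  W w = 𝒲 w × 𝓡E Γ w

  upper : Model
  upper = record
    { Carrier = FSet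
    ; _≈_     = _≐_
    ; Dom     = W
    ; R◇      = 𝓡◇
    ; RE      = 𝓡E
    ; Vp      = λ p w → w (prop p)
    ; Vn      = λ n w → Γ (E (nom n)) × w ≐ Δ n
    }


  -- The derived Henkin model M : φ̄.  Its points (w, φ̄) are represented
  -- by w (φ̄ is fixed); relations are those of M restricted to the domain.
  derived : List Form → Model
  derived φs = record
    { Carrier = FSet
    ; _≈_     = _≐_
    ; Dom     = λ w → W w × w (pre φs ⊤')
    ; R◇      = 𝓡◇
    ; RE      = 𝓡E
    ; Vp      = λ p w → w (prop p)
    ; Vn      = λ n w → w (nom n)
    }

  Φ : List Form → FSet → FSet
  Φ φs w α = w (pre φs α)

-- Every point of the derived model M:φ̄ is, up to ≐, one of the maximal theories Δ n, and the
-- claim is a truth lemma, proved by induction on ψ simultaneously for all announcement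
-- sequences φ̄.  A sequence φ̄ collapses to a single announcement ⟨!χ⟩, whose reduction axioms
-- turn the Boolean, ◇ and E cases into facts about the maximal theory at the point; pasting
-- supplies the witnesses for ◇ and E.  The φ-points of M:φ̄ form M:(φ̄,φ), which handles ⟨!φ⟩ψ,
-- and deleting the point named k leaves M:(φ̄,¬k), so by the Mix axiom and E-mixedness
-- ⟨-α⟩ψ reduces to E(k ∧ α) ∧ ⟨!¬k⟩ψ.

module Submission where

open import Defs
open import Level using (Lift; lift; lower) renaming (suc to lsuc; zero to lzero)
open import Data.Nat using (ℕ; suc)
open import Data.Bool using (Bool; true; false; not; T; _∧_; _∨_)
open import Data.Bool.Properties using (T-∧; T-≡)
open import Data.Fin using (Fin; zero; suc)
open import Data.Vec using (Vec; []; _∷_; lookup; map)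
open import Data.Vec.Properties using (lookup-map)
open import Data.List using (List; []; _∷_; _++_)
open import Data.List.Relation.Unary.All using (All; []; _∷_)
open import Data.Product using (∃; _×_; _,_; proj₁; proj₂)
open import Data.Product.Function.NonDependent.Propositional using (_×-⇔_)
open import Data.Product.Function.Dependent.Propositional using (Σ-⇔)
open import Data.Sum using (_⊎_; inj₁; inj₂; [_,_]; map₂)
open import Data.Sum.Function.Propositional using (_⊎-⇔_)
open import Data.Empty using (⊥; ⊥-elim)
open import Data.Unit.Polymorphic using (tt)
open import Function.Base using (id; _∘_)
open import Function.Bundles using (_⇔_; mk⇔; Equivalence)
open import Function.Construct.Identity using (⇔-id; ↠-id)
open import Function.Properties.Equivalence using () renaming (trans to ⇔-trans)
open import Function.Construct.Symmetry using (⇔-sym)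
open import Function.Related.TypeIsomorphisms using (¬-cong-⇔)
open import Function.Related.Propositional using (module EquationalReasoning; equivalence)
open import Relation.Nullary using (¬_)
open import Relation.Binary.PropositionalEquality using (_≡_; refl; sym; trans; cong; cong₂)

open Equivalence using (to; from)
open EquationalReasoning {k = equivalence}

private
  variable
    n : ℕ
    A B : Form
    w : FSet

infixr 30 ¬ₛ_
infixl 28 _∧ₛ_
infixl 27 _∨ₛ_
infixr 26 _⇒ₛ_
infix  25 _⇔ₛ_

-- Instances of a valid scheme are tautologies because tv treats non-Boolean subformulas as
-- atoms; validity is decided by evaluating the scheme under all assignments.
data Schema (n : ℕ) : Set where
  var  : Fin n → Schema n
  ⊤ₛ   : Schema n
  ¬ₛ_  : Schema n → Schema n
  _∨ₛ_ : Schema n → Schema n → Schema n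

_∧ₛ_ _⇒ₛ_ _⇔ₛ_ : Schema n → Schema n → Schema n
S ∧ₛ R = ¬ₛ (¬ₛ S ∨ₛ ¬ₛ R)
S ⇒ₛ R = ¬ₛ S ∨ₛ R
S ⇔ₛ R = (S ⇒ₛ R) ∧ₛ (R ⇒ₛ S)

x₀ : Schema (suc n)
x₀ = var zero

x₁ : Schema (suc (suc n))
x₁ = var (suc zero)

x₂ : Schema (suc (suc (suc n)))
x₂ = var (suc (suc zero))

instantiate : Vec Form n → Schema n → Form
instantiate σ (var i)  = lookup σ i
instantiate σ ⊤ₛ       = ⊤'
instantiate σ (¬ₛ S)   = ¬' instantiate σ S
instantiate σ (S ∨ₛ R) = instantiate σ S ∨' instantiate σ R

evaluate : Vec Bool n → Schema n → Bool
evaluate bs (var i)  = lookup bs i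
evaluate bs ⊤ₛ       = true
evaluate bs (¬ₛ S)   = not (evaluate bs S)
evaluate bs (S ∨ₛ R) = evaluate bs S ∨ evaluate bs R

tv-instantiate : ∀ v (σ : Vec Form n) S → tv v (instantiate σ S) ≡ evaluate (map (tv v) σ) S
tv-instantiate v σ (var i)  = sym (lookup-map i (tv v) σ)
tv-instantiate v σ ⊤ₛ       = refl
tv-instantiate v σ (¬ₛ S)   = cong not (tv-instantiate v σ S)
tv-instantiate v σ (S ∨ₛ R) = cong₂ _∨_ (tv-instantiate v σ S) (tv-instantiate v σ R)

allAssignments : ∀ n → (Vec Bool n → Bool) → Bool
allAssignments 0       f = f []
allAssignments (suc n) f = allAssignments n (f ∘ (true ∷_)) ∧ allAssignments n (f ∘ (false ∷_))

allAssignments-sound : ∀ n f → T (allAssignments n f) → ∀ bs → f bs ≡ true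
allAssignments-sound 0       f h []           = to T-≡ h
allAssignments-sound (suc n) f h (true ∷ bs)  = allAssignments-sound n _ (proj₁ (to T-∧ h)) bs
allAssignments-sound (suc n) f h (false ∷ bs) = allAssignments-sound n _ (proj₂ (to T-∧ h)) bs

Valid : Schema n → Set
Valid {n} S = T (allAssignments n (λ bs → evaluate bs S))

tautology : (S : Schema n) → {Valid S} → (σ : Vec Form n) → ⊢ instantiate σ S
tautology {n} S {valid} σ =
  taut λ v → trans (tv-instantiate v σ S) (allAssignments-sound n _ valid (map (tv v) σ))

⊢-¬¬ : ∀ A → ⊢ ¬' ¬' A ⇔' A
⊢-¬¬ A = tautology (¬ₛ ¬ₛ x₀ ⇔ₛ x₀) (A ∷ [])

⊢⇔-sym : ⊢ A ⇔' B → ⊢ B ⇔' A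
⊢⇔-sym {A} {B} = mp (tautology ((x₀ ⇔ₛ x₁) ⇒ₛ (x₁ ⇔ₛ x₀)) (A ∷ B ∷ []))

⊢⇔-trans : ∀ {C} → ⊢ A ⇔' B → ⊢ B ⇔' C → ⊢ A ⇔' C
⊢⇔-trans {A} {B} {C} h = mp (mp (tautology ((x₀ ⇔ₛ x₁) ⇒ₛ (x₁ ⇔ₛ x₂) ⇒ₛ (x₀ ⇔ₛ x₂)) (A ∷ B ∷ C ∷ [])) h)

record MaxTheory (w : FSet) : Set where
  field
    closed     : ⊢ A ⇒' B → w A → w B
    ∧-closed   : w A → w B → w (A ∧' B)
    complete   : ∀ A → w A ⊎ w (¬' A)
    consistent : w A → w (¬' A) → ⊥

maximalConsistent⇒maxTheory : ∀ {Γ} → MaximalConsistent Γ → MaxTheory Γ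
maximalConsistent⇒maxTheory {Γ} (consistent , complete) = record
  { closed     = λ {A} {B} ⊢A⇒B a → derive (A ∷ []) (a ∷ [])
                   (mp (tautology ((x₀ ⇒ₛ x₁) ⇒ₛ x₀ ∧ₛ ⊤ₛ ⇒ₛ x₁) (A ∷ B ∷ [])) ⊢A⇒B)
  ; ∧-closed   = λ {A} {B} a b → derive (A ∷ B ∷ []) (a ∷ b ∷ [])
                   (tautology (x₀ ∧ₛ (x₁ ∧ₛ ⊤ₛ) ⇒ₛ x₀ ∧ₛ x₁) (A ∷ B ∷ []))
  ; complete   = complete
  ; consistent = λ {A} a ¬a → consistent (A ∷ ¬' A ∷ []) (a ∷ ¬a ∷ [])
                   (tautology (¬ₛ (x₀ ∧ₛ (¬ₛ x₀ ∧ₛ ⊤ₛ))) (A ∷ []))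
  }
  where
  derive : ∀ {B} L → All Γ L → ⊢ conj L ⇒' B → Γ B
  derive {B} L L⊆Γ ⊢L⇒B with complete B
  ... | inj₁ b  = b
  ... | inj₂ ¬b = ⊥-elim (consistent (¬' B ∷ L) (¬b ∷ L⊆Γ)
                    (mp (tautology ((x₀ ⇒ₛ x₁) ⇒ₛ ¬ₛ (¬ₛ x₁ ∧ₛ x₀)) (conj L ∷ B ∷ [])) ⊢L⇒B))

maxTheory-resp-≐ : ∀ {v} → w ≐ v → MaxTheory v → MaxTheory w
maxTheory-resp-≐ {w} w≐v th = record
  { closed     = λ ⊢A⇒B → back ∘ closed ⊢A⇒B ∘ forth
  ; ∧-closed   = λ a b → back (∧-closed (forth a) (forth b))
  ; complete   = λ A → [ inj₁ ∘ back , inj₂ ∘ back ] (complete A)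
  ; consistent = λ a ¬a → consistent (forth a) (forth ¬a)
  }
  where
  open MaxTheory th
  forth = λ {A} → proj₁ (w≐v A)
  back  = λ {A} → proj₂ (w≐v A)

infixr 30 ■[_]_

■[_]_ : (Form → Form) → Form → Form
■[ ◆ ] A = ¬' ◆ (¬' A)

record NormalDiamond (◆ : Form → Form) : Set where
  field
    ◆-cong : ⊢ A ⇔' B → ⊢ ◆ A ⇔' ◆ B
    K      : ∀ A B → ⊢ ■[ ◆ ] (A ⇒' B) ⇒' (■[ ◆ ] A ⇒' ■[ ◆ ] B)
    nec    : ⊢ A → ⊢ ■[ ◆ ] A

◇-normal : NormalDiamond ◇_
◇-normal = record { ◆-cong = repl (c◇ hole) ; K = K□ ; nec = nec□ }

E-normal : NormalDiamond E_
E-normal = record { ◆-cong = repl (cE hole) ; K = KU ; nec = necU }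

!-normal : ∀ χ → NormalDiamond (⟨! χ ⟩_)
!-normal χ = record { ◆-cong = repl (c!ʳ χ hole) ; K = K! χ ; nec = nec! χ }

module MaxTheoryProperties {w : FSet} (th : MaxTheory w) where
  open MaxTheory th public

  ⊢⇒∈ : ⊢ A → w A
  ⊢⇒∈ {A} ⊢A = [ id , closed (mp (tautology (x₀ ⇒ₛ ¬ₛ x₀ ⇒ₛ x₀) (A ∷ [])) ⊢A) ] (complete A)

  ¬∈ : w (¬' A) ⇔ (¬ w A)
  ¬∈ {A} = mk⇔ (λ ¬a a → consistent a ¬a) (λ ∉ → [ ⊥-elim ∘ ∉ , id ] (complete A))

  stable : ¬ ¬ w A → w A
  stable {A} ¬¬a = [ id , ⊥-elim ∘ ¬¬a ∘ to ¬∈ ] (complete A)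

  ⇒∈ : w (A ⇒' B) → w A → w B
  ⇒∈ {A} {B} i a = closed (tautology (x₀ ∧ₛ (x₀ ⇒ₛ x₁) ⇒ₛ x₁) (A ∷ B ∷ [])) (∧-closed a i)

  ∨∈ : w (A ∨' B) ⇔ (w A ⊎ w B)
  ∨∈ {A} {B} = mk⇔ split [ closed (tautology (x₀ ⇒ₛ x₀ ∨ₛ x₁) (A ∷ B ∷ []))
                           , closed (tautology (x₁ ⇒ₛ x₀ ∨ₛ x₁) (A ∷ B ∷ [])) ]
    where
    split : w (A ∨' B) → w A ⊎ w B
    split a∨b = [ inj₁ , (λ ¬a → inj₂ (closed (tautology (¬ₛ x₀ ∧ₛ (x₀ ∨ₛ x₁) ⇒ₛ x₁) (A ∷ B ∷ []))
                                                (∧-closed ¬a a∨b))) ] (complete A)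

  ∧∈ : w (A ∧' B) ⇔ (w A × w B)
  ∧∈ {A} {B} = mk⇔ (λ a∧b → closed (tautology (x₀ ∧ₛ x₁ ⇒ₛ x₀) (A ∷ B ∷ [])) a∧b
                            , closed (tautology (x₀ ∧ₛ x₁ ⇒ₛ x₁) (A ∷ B ∷ [])) a∧b)
                   (λ (a , b) → ∧-closed a b)

  ⊢⇔⇒∈⇔ : ⊢ A ⇔' B → w A ⇔ w B
  ⊢⇔⇒∈⇔ {A} {B} h = mk⇔ (closed (mp (tautology ((x₀ ⇔ₛ x₁) ⇒ₛ x₀ ⇒ₛ x₁) (A ∷ B ∷ [])) h))
                        (closed (mp (tautology ((x₀ ⇔ₛ x₁) ⇒ₛ x₁ ⇒ₛ x₀) (A ∷ B ∷ [])) h))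

  module _ {◆ : Form → Form} (normal : NormalDiamond ◆) where
    open NormalDiamond normal

    ■-mono : ⊢ A ⇒' B → w (■[ ◆ ] A) → w (■[ ◆ ] B)
    ■-mono {A} {B} h = ⇒∈ (⇒∈ (⊢⇒∈ (K A B)) (⊢⇒∈ (nec h)))

    ■¬⇔¬◆ : w (■[ ◆ ] (¬' A)) ⇔ (¬ w (◆ A))
    ■¬⇔¬◆ {A} = begin
      w (¬' ◆ (¬' ¬' A)) ∼⟨ ¬∈ ⟩
      (¬ w (◆ (¬' ¬' A))) ∼⟨ ¬-cong-⇔ (⊢⇔⇒∈⇔ (◆-cong (⊢-¬¬ A))) ⟩
      (¬ w (◆ A))         ∎

    ◆-K : w (■[ ◆ ] (A ⇒' B)) → w (◆ A) → w (◆ B)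
    ◆-K {A} {B} □A⇒B ◆A = stable λ ¬◆B →
      to ■¬⇔¬◆ (⇒∈ (⇒∈ (⊢⇒∈ (K (¬' B) (¬' A)))
                       (■-mono (tautology ((x₀ ⇒ₛ x₁) ⇒ₛ ¬ₛ x₁ ⇒ₛ ¬ₛ x₀) (A ∷ B ∷ [])) □A⇒B))
                  (from ■¬⇔¬◆ ¬◆B))
               ◆A

    ◆-mono : ⊢ A ⇒' B → w (◆ A) → w (◆ B)
    ◆-mono h = ◆-K (⊢⇒∈ (nec h))

composite : List Form → Form
composite []       = ⊤'
composite (φ ∷ φs) = φ ∧' [! φ ] composite φs

pre-composite : ∀ φs α → ⊢ pre φs α ⇔' ⟨! composite φs ⟩ α
pre-composite []       α = ⊢⇔-sym (!⊤ax α)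
pre-composite (φ ∷ φs) α = ⊢⇔-trans (repl (c!ʳ φ hole) (pre-composite φs α)) (!! φ (composite φs) α)

pre-cong : ∀ φs → ⊢ A ⇔' B → ⊢ pre φs A ⇔' pre φs B
pre-cong []       h = h
pre-cong (φ ∷ φs) h = repl (c!ʳ φ hole) (pre-cong φs h)

pre-++ : ∀ φs ψs α → pre (φs ++ ψs) α ≡ pre φs (pre ψs α)
pre-++ []       ψs α = refl
pre-++ (φ ∷ φs) ψs α = cong (⟨! φ ⟩_) (pre-++ φs ψs α)

module PrefixProperties {w : FSet} (th : MaxTheory w) (φs : List Form) where
  open MaxTheoryProperties th

  private
    P : Form → Form
    P = pre φs

    χ : Form
    χ = composite φs

    P⇔composite : w (P A) ⇔ w (⟨! χ ⟩ A)
    P⇔composite = ⊢⇔⇒∈⇔ (pre-composite φs _)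

    P⊤⇔χ : w (P ⊤') ⇔ w χ
    P⊤⇔χ = begin
      w (P ⊤')       ∼⟨ P⇔composite ⟩
      w (⟨! χ ⟩ ⊤')  ∼⟨ ⊢⇔⇒∈⇔ (!⊤ χ) ⟩
      w χ            ∎

  pre-mono : ⊢ A ⇒' B → w (P A) → w (P B)
  pre-mono h = from P⇔composite ∘ ◆-mono (!-normal χ) h ∘ to P⇔composite

  pre-⊤ : w (P A) → w (P ⊤')
  pre-⊤ {A} = pre-mono (tautology (x₀ ⇒ₛ ⊤ₛ) (A ∷ []))

  pre-atom : (∀ χ → ⊢ ⟨! χ ⟩ A ⇔' (χ ∧' A)) → w (P A) ⇔ (w (P ⊤') × w A)
  pre-atom {A} reduce = begin
    w (P A)              ∼⟨ P⇔composite ⟩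
    w (⟨! χ ⟩ A)         ∼⟨ ⊢⇔⇒∈⇔ (reduce χ) ⟩
    w (χ ∧' A)           ∼⟨ ∧∈ ⟩
    (w χ × w A)          ∼⟨ ⇔-sym P⊤⇔χ ×-⇔ ⇔-id _ ⟩
    (w (P ⊤') × w A)     ∎

  pre-prop : ∀ p → w (P (prop p)) ⇔ (w (P ⊤') × w (prop p))
  pre-prop p = pre-atom (λ χ → !p χ p)

  pre-nom : ∀ k → w (P (nom k)) ⇔ (w (P ⊤') × w (nom k))
  pre-nom k = pre-atom (λ χ → !n χ k)

  pre-¬ : w (P ⊤') → w (P (¬' A)) ⇔ (¬ w (P A))
  pre-¬ {A} P⊤ = begin
    w (P (¬' A))                  ∼⟨ P⇔composite ⟩
    w (⟨! χ ⟩ ¬' A)               ∼⟨ ⊢⇔⇒∈⇔ (!¬ χ A) ⟩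
    w (χ ∧' ¬' ⟨! χ ⟩ A)          ∼⟨ ∧∈ ⟩
    (w χ × w (¬' ⟨! χ ⟩ A))       ∼⟨ mk⇔ proj₂ (to P⊤⇔χ P⊤ ,_) ⟩
    w (¬' ⟨! χ ⟩ A)               ∼⟨ ¬∈ ⟩
    (¬ w (⟨! χ ⟩ A))              ∼⟨ ¬-cong-⇔ (⇔-sym P⇔composite) ⟩
    (¬ w (P A))                   ∎

  pre-∨ : w (P (A ∨' B)) ⇔ (w (P A) ⊎ w (P B))
  pre-∨ {A} {B} = begin
    w (P (A ∨' B))                      ∼⟨ P⇔composite ⟩
    w (⟨! χ ⟩ (A ∨' B))                 ∼⟨ ⊢⇔⇒∈⇔ (!∨ χ A B) ⟩
    w (⟨! χ ⟩ A ∨' ⟨! χ ⟩ B)            ∼⟨ ∨∈ ⟩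
    (w (⟨! χ ⟩ A) ⊎ w (⟨! χ ⟩ B))       ∼⟨ ⇔-sym P⇔composite ⊎-⇔ ⇔-sym P⇔composite ⟩
    (w (P A) ⊎ w (P B))                 ∎

  pre-∧ : w (P (A ∧' B)) ⇔ (w (P A) × w (P B))
  pre-∧ = mk⇔ (λ a∧b → to (given (pre-⊤ a∧b)) a∧b) (λ (a , b) → from (given (pre-⊤ a)) (a , b))
    where
    given : w (P ⊤') → w (P (A ∧' B)) ⇔ (w (P A) × w (P B))
    given {A} {B} P⊤ = begin
      w (P (¬' (¬' A ∨' ¬' B)))            ∼⟨ pre-¬ P⊤ ⟩
      (¬ w (P (¬' A ∨' ¬' B)))             ∼⟨ ¬-cong-⇔ pre-∨ ⟩
      (¬ (w (P (¬' A)) ⊎ w (P (¬' B))))    ∼⟨ ¬-cong-⇔ (pre-¬ P⊤ ⊎-⇔ pre-¬ P⊤) ⟩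
      (¬ (¬ w (P A) ⊎ ¬ w (P B)))          ∼⟨ mk⇔ (λ h → stable (h ∘ inj₁) , stable (h ∘ inj₂))
                                                   (λ (a , b) → [ (λ ¬a → ¬a a) , (λ ¬b → ¬b b) ]) ⟩
      (w (P A) × w (P B))                  ∎

  pre-◆ : ∀ {◆} → NormalDiamond ◆ → (∀ χ A → ⊢ ⟨! χ ⟩ ◆ A ⇔' (χ ∧' ◆ (⟨! χ ⟩ A))) →
          w (P (◆ A)) ⇔ (w (P ⊤') × w (◆ (P A)))
  pre-◆ {A} {◆} normal reduce = begin
    w (P (◆ A))                  ∼⟨ P⇔composite ⟩
    w (⟨! χ ⟩ ◆ A)               ∼⟨ ⊢⇔⇒∈⇔ (reduce χ A) ⟩
    w (χ ∧' ◆ (⟨! χ ⟩ A))        ∼⟨ ∧∈ ⟩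
    (w χ × w (◆ (⟨! χ ⟩ A)))     ∼⟨ ⇔-sym P⊤⇔χ ×-⇔ ⊢⇔⇒∈⇔ (◆-cong (⊢⇔-sym (pre-composite φs A))) ⟩
    (w (P ⊤') × w (◆ (P A)))     ∎
    where open NormalDiamond normal

  pre-◇ : w (P (◇ A)) ⇔ (w (P ⊤') × w (◇ P A))
  pre-◇ = pre-◆ ◇-normal !◇

  pre-E : w (P (E A)) ⇔ (w (P ⊤') × w (E P A))
  pre-E = pre-◆ E-normal !E

  pre-snoc : ∀ φ → w (pre (φs ++ φ ∷ []) A) ⇔ w (P (⟨! φ ⟩ A))
  pre-snoc {A} φ rewrite pre-++ φs (φ ∷ []) A = ⇔-id _

  pre-snoc-⊤ : ∀ φ → w (pre (φs ++ φ ∷ []) ⊤') ⇔ w (P φ)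
  pre-snoc-⊤ φ = begin
    w (pre (φs ++ φ ∷ []) ⊤')  ∼⟨ pre-snoc φ ⟩
    w (P (⟨! φ ⟩ ⊤'))          ∼⟨ ⊢⇔⇒∈⇔ (pre-cong φs (!⊤ φ)) ⟩
    w (P φ)                    ∎

≐-refl : w ≐ w
≐-refl φ = id , id

≐-sym : ∀ {v} → w ≐ v → v ≐ w
≐-sym w≐v φ = proj₂ (w≐v φ) , proj₁ (w≐v φ)

≐-trans : ∀ {u v} → u ≐ w → w ≐ v → u ≐ v
≐-trans u≐w w≐v φ = proj₁ (w≐v φ) ∘ proj₁ (u≐w φ) , proj₂ (u≐w φ) ∘ proj₂ (w≐v φ)

module Canonical {Γ : FSet} (Γ-mc : MaximalConsistent Γ) where
  open Henkin Γ
  open MaxTheoryProperties (maximalConsistent⇒maxTheory Γ-mc) public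

  E-mono : ⊢ A ⇒' B → Γ (E A) → Γ (E B)
  E-mono = ◆-mono E-normal

  E-∧ˡ : Γ (E (A ∧' B)) → Γ (E A)
  E-∧ˡ {A} {B} = E-mono (tautology (x₀ ∧ₛ x₁ ⇒ₛ x₀) (A ∷ B ∷ []))

  E-∧ʳ : Γ (E (A ∧' B)) → Γ (E B)
  E-∧ʳ {A} {B} = E-mono (tautology (x₀ ∧ₛ x₁ ⇒ₛ x₁) (A ∷ B ∷ []))

  E-intro : Γ A → Γ (E A)
  E-intro {A} a = stable λ ¬EA → to ¬∈ (⇒∈ (⊢⇒∈ (TU (¬' A))) (from (■¬⇔¬◆ E-normal) ¬EA)) a

  E-named⇒U : Γ (E (nom n ∧' A)) → Γ (U (nom n ⇒' A))
  E-named⇒U = ⇒∈ (⊢⇒∈ (H _ _))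

  U∧E : Γ (U A) → Γ (E B) → Γ (E (A ∧' B))
  U∧E {A} {B} = ◆-K E-normal ∘ ■-mono E-normal (tautology (x₀ ⇒ₛ x₁ ⇒ₛ x₀ ∧ₛ x₁) (A ∷ B ∷ []))

  Δ-theory : Γ (E (nom n)) → MaxTheory (Δ n)
  Δ-theory {n} En = record
    { closed     = λ {A} {B} ⊢A⇒B → E-mono
                     (mp (tautology ((x₀ ⇒ₛ x₁) ⇒ₛ x₂ ∧ₛ x₀ ⇒ₛ x₂ ∧ₛ x₁) (A ∷ B ∷ nom n ∷ [])) ⊢A⇒B)
    ; ∧-closed   = λ {A} {B} a b → E-mono
                     (tautology ((x₂ ⇒ₛ x₀) ∧ₛ (x₂ ∧ₛ x₁) ⇒ₛ x₂ ∧ₛ (x₀ ∧ₛ x₁)) (A ∷ B ∷ nom n ∷ []))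
                     (U∧E (E-named⇒U a) b)
    ; complete   = λ A → map₂ (refute A ∘ to ¬∈) (complete (E (nom n ∧' A)))
    ; consistent = λ {A} a ¬a → consistent
                     (E-mono (tautology ((x₁ ⇒ₛ x₀) ∧ₛ (x₁ ∧ₛ ¬ₛ x₀) ⇒ₛ ¬ₛ ⊤ₛ) (A ∷ nom n ∷ []))
                             (U∧E (E-named⇒U a) ¬a))
                     (⊢⇒∈ (necU (tautology ⊤ₛ [])))
    }
    where
    refute : ∀ A → ¬ Γ (E (nom n ∧' A)) → Δ n (¬' A)
    refute A ¬EnA = E-mono (tautology (¬ₛ (x₁ ∧ₛ x₀) ∧ₛ x₁ ⇒ₛ x₁ ∧ₛ ¬ₛ x₀) (A ∷ nom n ∷ []))
                           (U∧E (from (■¬⇔¬◆ E-normal) ¬EnA) En)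

  Γ≐Δ : Γ (nom n) → Γ ≐ Δ n
  Γ≐Δ n∈Γ A = (λ a → E-intro (∧-closed n∈Γ a))
            , (λ d → ⇒∈ (⇒∈ (⊢⇒∈ (TU _)) (E-named⇒U d)) n∈Γ)

  Δ-nom : Γ (E (nom n)) → Δ n (nom n)
  Δ-nom {n} = E-mono (tautology (x₀ ⇒ₛ x₀ ∧ₛ x₀) (nom n ∷ []))

  Δ-≐ : ∀ {j k} → Γ (E (nom j ∧' nom k)) → Δ j ≐ Δ k
  Δ-≐ {j} {k} jk A = ⊆ jk , ⊆ (E-mono (tautology (x₀ ∧ₛ x₁ ⇒ₛ x₁ ∧ₛ x₀) (nom j ∷ nom k ∷ [])) jk)
    where
    ⊆ : ∀ {j k} → Γ (E (nom j ∧' nom k)) → Δ j A → Δ k A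
    ⊆ {j} {k} jk a = E-mono (tautology (x₀ ∧ₛ (x₁ ∧ₛ x₂) ⇒ₛ x₁ ∧ₛ x₂) (nom j ∷ nom k ∷ A ∷ []))
                            (MaxTheory.∧-closed (Δ-theory (E-∧ˡ jk)) jk a)

  IsΔ⇒≐ : IsΔ n w → Γ (E (nom n)) × w ≐ Δ n
  IsΔ⇒≐ (inj₁ En≐)          = En≐
  IsΔ⇒≐ (inj₂ (n∈Γ , w≐Γ)) = E-intro n∈Γ , ≐-trans w≐Γ (Γ≐Δ n∈Γ)

module _ {Γ : FSet} where
  open Henkin Γ

  sat-resp-Dom : ∀ ψ φs φs′ {D D′ : FSet → Set₁} → (∀ t → D t ⇔ D′ t) → ∀ s →
                 sat (derived φs) D s ψ ⇔ sat (derived φs′) D′ s ψ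
  sat-resp-Dom (prop p)   φs φs′ D⇔D′ s = D⇔D′ s ×-⇔ ⇔-id _
  sat-resp-Dom (nom k)    φs φs′ D⇔D′ s = D⇔D′ s ×-⇔ ⇔-id _
  sat-resp-Dom ⊤'         φs φs′ D⇔D′ s = ⇔-id _
  sat-resp-Dom (¬' ψ)     φs φs′ D⇔D′ s = ¬-cong-⇔ (sat-resp-Dom ψ φs φs′ D⇔D′ s)
  sat-resp-Dom (ψ ∨' α)   φs φs′ D⇔D′ s = sat-resp-Dom ψ φs φs′ D⇔D′ s ⊎-⇔ sat-resp-Dom α φs φs′ D⇔D′ s
  sat-resp-Dom (◇ ψ)      φs φs′ D⇔D′ s =
    Σ-⇔ (↠-id _) λ {t} → D⇔D′ t ×-⇔ ⇔-id _ ×-⇔ sat-resp-Dom ψ φs φs′ D⇔D′ t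
  sat-resp-Dom (E ψ)      φs φs′ D⇔D′ s =
    Σ-⇔ (↠-id _) λ {t} → D⇔D′ t ×-⇔ sat-resp-Dom ψ φs φs′ D⇔D′ t
  sat-resp-Dom (⟨! φ ⟩ ψ) φs φs′ D⇔D′ s =
    sat-resp-Dom φ φs φs′ D⇔D′ s
      ×-⇔ sat-resp-Dom ψ φs φs′ (λ t → D⇔D′ t ×-⇔ sat-resp-Dom φ φs φs′ D⇔D′ t) s
  sat-resp-Dom (⟨- α ⟩ ψ) φs φs′ D⇔D′ s =
    Σ-⇔ (↠-id _) λ {t} → D⇔D′ t ×-⇔ ⇔-id _ ×-⇔ sat-resp-Dom α φs φs′ D⇔D′ t
                          ×-⇔ sat-resp-Dom ψ φs φs′ (λ u → D⇔D′ u ×-⇔ ⇔-id _) s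

module TruthLemma {Γ : FSet} (Γ-mc : MaximalConsistent Γ) (named : Named Γ)
                  (pasted◇ : Pasted ∇◇ Γ) (pastedE : Pasted ∇E Γ) (eMixed : EMixed Γ) where
  open Henkin Γ
  open Canonical Γ-mc

  𝒲⇒Δ : 𝒲 w → ∃ λ n → Γ (E (nom n)) × w ≐ Δ n
  𝒲⇒Δ (inj₁ w≐Γ) = proj₁ named , IsΔ⇒≐ (inj₂ (proj₂ named , w≐Γ))
  𝒲⇒Δ (inj₂ Δn)  = Δn

  W-theory : W w → MaxTheory w
  W-theory (w∈𝒲 , _) = let (n , En , w≐Δn) = 𝒲⇒Δ w∈𝒲 in maxTheory-resp-≐ w≐Δn (Δ-theory En)

  Δ∈W : Γ (E (nom n)) → W (Δ n)
  Δ∈W {n} En = inj₂ (n , En , ≐-refl)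
             , (n₀ , n , inj₂ (n₀∈Γ , ≐-refl) , inj₁ (En , ≐-refl) , E-intro (∧-closed n₀∈Γ En))
    where
    n₀ = proj₁ named
    n₀∈Γ = proj₂ named

  W-∈⇒E : W w → w A → Γ (E A)
  W-∈⇒E (w∈𝒲 , _) a = let (n , _ , w≐Δn) = 𝒲⇒Δ w∈𝒲 in E-∧ʳ (proj₁ (w≐Δn _) a)

  W-nom⇔≐Δ : ∀ {k} → W w → Γ (E (nom k)) → w (nom k) ⇔ (w ≐ Δ k)
  W-nom⇔≐Δ {k = k} (w∈𝒲 , _) Ek = let (j , _ , w≐Δj) = 𝒲⇒Δ w∈𝒲 in
    mk⇔ (λ k∈w → ≐-trans w≐Δj (Δ-≐ (proj₁ (w≐Δj (nom k)) k∈w)))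
        (λ w≐Δk → proj₂ (w≐Δk (nom k)) (Δ-nom Ek))

  Δ-U : Γ (E (nom n)) → Γ (U A) → Δ n (U A)
  Δ-U {n} {A} En UA = Δn.stable λ UA∉Δn →
    let E¬A∈Δn = Δn.closed (tautology (¬ₛ ¬ₛ x₀ ⇒ₛ x₀) (E (¬' A) ∷ [])) (from Δn.¬∈ UA∉Δn)
        (_ , m¬A) = to ∧∈ (proj₂ (pastedE n (¬' A) E¬A∈Δn))
    in to ¬∈ UA (E-∧ʳ m¬A)
    where module Δn = MaxTheoryProperties (Δ-theory En)

  W-U : W w → Γ (U A) → w (U A)
  W-U (w∈𝒲 , _) UA = let (n , En , w≐Δn) = 𝒲⇒Δ w∈𝒲 in proj₂ (w≐Δn _) (Δ-U En UA)

  W-E : W w → Γ (E A) → w (E A)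
  W-E {A = A} Ww EA = Ww.⇒∈ (Ww.⊢⇒∈ (TU (E A))) (W-U Ww (⇒∈ (⊢⇒∈ (5U A)) EA))
    where module Ww = MaxTheoryProperties (W-theory Ww)

  Δ-◇ : ∀ {m} → Γ (E (nom n)) → Γ (E (nom n ∧' ◇ nom m)) → Γ (E (nom m ∧' A)) → Δ n (◇ A)
  Δ-◇ En n◇m mA = Δn.◆-K ◇-normal (Δn.⇒∈ (Δn.⊢⇒∈ (U□ _)) (Δ-U En (E-named⇒U mA))) n◇m
    where module Δn = MaxTheoryProperties (Δ-theory En)

  W-E-witness : W w → w (E A) → ∃ λ m → Γ (E (nom m ∧' A))
  W-E-witness {A = A} (w∈𝒲 , _) EA =
    let (n , _ , w≐Δn) = 𝒲⇒Δ w∈𝒲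
        (m , nEm∧mA)   = pastedE n A (proj₁ (w≐Δn _) EA)
    in m , proj₂ (to ∧∈ nEm∧mA)

  W-mixed : ∀ {φs α ψ} → W w → w (pre φs (⟨- α ⟩ ψ)) →
            ∃ λ k → w (pre φs (E (nom k ∧' α) ∧' ⟨! ¬' nom k ⟩ ψ))
  W-mixed {φs = φs} {α} {ψ} (w∈𝒲 , _) x =
    let (n , En , w≐Δn) = 𝒲⇒Δ w∈𝒲
        via-composite = λ A → MaxTheoryProperties.⊢⇔⇒∈⇔ (Δ-theory En) (pre-composite φs A)
        (k , mixed) = eMixed n (composite φs) α ψ (to (via-composite _) (proj₁ (w≐Δn _) x))
    in k , proj₂ (w≐Δn _) (from (via-composite _) mixed)

  Dom : List Form → FSet → Set
  Dom φs = Model.Dom (derived φs)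

  Dom↑ : List Form → FSet → Set₁
  Dom↑ φs t = Lift (lsuc lzero) (Dom φs t)

  Truth : Form → Set₁
  Truth ψ = ∀ φs w → Dom φs w → sat (derived φs) (Dom↑ φs) w ψ ⇔ w (pre φs ψ)

  Δ-sat : ∀ {ψ} → Truth ψ → ∀ φs {m} → Γ (E (nom m ∧' pre φs ψ)) →
            Dom↑ φs (Δ m) × sat (derived φs) (Dom↑ φs) (Δ m) ψ
  Δ-sat ih φs {m} mψ = lift dm , from (ih φs (Δ m) dm) mψ
    where dm = Δ∈W (E-∧ˡ mψ) , PrefixProperties.pre-⊤ (Δ-theory (E-∧ˡ mψ)) φs mψ

  announced-domain : ∀ {φ} → Truth φ → ∀ φs t →
                     (Dom↑ φs t × sat (derived φs) (Dom↑ φs) t φ) ⇔ Dom↑ (φs ++ φ ∷ []) t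
  announced-domain {φ} ih φs t = mk⇔
    (λ (lift (Wt , P⊤) , sφ) → lift (Wt , from (pre-snoc-⊤ Wt φ) (to (ih φs t (Wt , P⊤)) sφ)))
    (λ (lift (Wt , x)) → let Pφ = to (pre-snoc-⊤ Wt φ) x; dt = Wt , pre-⊤ Wt Pφ in
                         lift dt , from (ih φs t dt) Pφ)
    where open module Pre (Wt : W t) = PrefixProperties (W-theory Wt) φs

  removed-domain : ∀ φs {t k} → t ≐ Δ k → Γ (E (nom k)) → ∀ u →
                   (Dom↑ φs u × ¬ Lift (lsuc lzero) (u ≐ t)) ⇔ Dom↑ (φs ++ ¬' nom k ∷ []) u
  removed-domain φs {t} {k} t≐Δk Ek u = mk⇔
    (λ (lift (Wu , P⊤) , u≉t) → lift (Wu , from (pre-snoc-⊤ Wu (¬' nom k)) (from (pre-¬ Wu P⊤)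
       λ Pk → u≉t (lift (≐-trans (to (W-nom⇔≐Δ Wu Ek) (proj₂ (to (pre-nom Wu k) Pk))) (≐-sym t≐Δk))))))
    (λ (lift (Wu , x)) → let P¬k = to (pre-snoc-⊤ Wu (¬' nom k)) x; P⊤ = pre-⊤ Wu P¬k in
       lift (Wu , P⊤) , λ (lift u≐t) →
         to (pre-¬ Wu P⊤) P¬k (from (pre-nom Wu k) (P⊤ , from (W-nom⇔≐Δ Wu Ek) (≐-trans u≐t t≐Δk))))
    where open module Pre (Wu : W u) = PrefixProperties (W-theory Wu) φs

  truth-atom : ∀ {a} φs w → Dom φs w → w (pre φs a) ⇔ (w (pre φs ⊤') × w a) →
               (Dom↑ φs w × Lift (lsuc lzero) (w a)) ⇔ w (pre φs a)
  truth-atom φs w d@(_ , P⊤) reduce =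
    mk⇔ (λ (_ , lift a) → from reduce (P⊤ , a)) (λ x → lift d , lift (proj₂ (to reduce x)))

  truth-¬ : ∀ {ψ} → Truth ψ → Truth (¬' ψ)
  truth-¬ ih φs w d@(Ww , P⊤) = ⇔-trans (¬-cong-⇔ (ih φs w d)) (⇔-sym (pre-¬ P⊤))
    where open PrefixProperties (W-theory Ww) φs

  truth-∨ : ∀ {ψ α} → Truth ψ → Truth α → Truth (ψ ∨' α)
  truth-∨ ihψ ihα φs w d@(Ww , _) = ⇔-trans (ihψ φs w d ⊎-⇔ ihα φs w d) (⇔-sym pre-∨)
    where open PrefixProperties (W-theory Ww) φs

  truth-◇ : ∀ {ψ} → Truth ψ → Truth (◇ ψ)
  truth-◇ {ψ} ih φs w d@(Ww , P⊤) = mk⇔ ⊨⇒∈ ∈⇒⊨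
    where
    open PrefixProperties (W-theory Ww) φs

    ⊨⇒∈ : sat (derived φs) (Dom↑ φs) w (◇ ψ) → w (pre φs (◇ ψ))
    ⊨⇒∈ (t , lift dt , lift (n , m , w-is-n , t-is-m , n◇m) , sψ) =
      let (En , w≐Δn) = IsΔ⇒≐ w-is-n
          (_  , t≐Δm) = IsΔ⇒≐ t-is-m
      in from pre-◇ (P⊤ , proj₂ (w≐Δn _) (Δ-◇ En n◇m (proj₁ (t≐Δm _) (to (ih φs t dt) sψ))))

    ∈⇒⊨ : w (pre φs (◇ ψ)) → sat (derived φs) (Dom↑ φs) w (◇ ψ)
    ∈⇒⊨ x =
      let (n , En , w≐Δn) = 𝒲⇒Δ (proj₁ Ww)
          (m , n◇m∧mψ)   = pasted◇ n (pre φs ψ) (proj₁ (w≐Δn _) (proj₂ (to pre-◇ x)))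
          (n◇m , mψ)      = to ∧∈ n◇m∧mψ
          (dm , sψ)       = Δ-sat ih φs mψ
      in Δ m , dm , lift (n , m , inj₁ (En , w≐Δn) , inj₁ (E-∧ˡ mψ , ≐-refl) , n◇m) , sψ

  truth-E : ∀ {ψ} → Truth ψ → Truth (E ψ)
  truth-E {ψ} ih φs w d@(Ww , P⊤) = mk⇔ ⊨⇒∈ ∈⇒⊨
    where
    open PrefixProperties (W-theory Ww) φs

    ⊨⇒∈ : sat (derived φs) (Dom↑ φs) w (E ψ) → w (pre φs (E ψ))
    ⊨⇒∈ (t , lift dt , sψ) = from pre-E (P⊤ , W-E Ww (W-∈⇒E (proj₁ dt) (to (ih φs t dt) sψ)))

    ∈⇒⊨ : w (pre φs (E ψ)) → sat (derived φs) (Dom↑ φs) w (E ψ)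
    ∈⇒⊨ x = let (m , mψ) = W-E-witness Ww (proj₂ (to pre-E x)) in Δ m , Δ-sat ih φs mψ

  truth-⟨!⟩ : ∀ {φ ψ} → Truth φ → Truth ψ → Truth (⟨! φ ⟩ ψ)
  truth-⟨!⟩ {φ} {ψ} ihφ ihψ φs w d@(Ww , _) = mk⇔ ⊨⇒∈ ∈⇒⊨
    where
    open PrefixProperties (W-theory Ww) φs
    φs⁺ = φs ++ φ ∷ []
    shift = sat-resp-Dom ψ φs φs⁺ (announced-domain ihφ φs) w

    ⊨⇒∈ : sat (derived φs) (Dom↑ φs) w (⟨! φ ⟩ ψ) → w (pre φs (⟨! φ ⟩ ψ))
    ⊨⇒∈ (sφ , sψ) = to (pre-snoc φ) (to (ihψ φs⁺ w d⁺) (to shift sψ))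
      where d⁺ = lower (to (announced-domain ihφ φs w) (lift d , sφ))

    ∈⇒⊨ : w (pre φs (⟨! φ ⟩ ψ)) → sat (derived φs) (Dom↑ φs) w (⟨! φ ⟩ ψ)
    ∈⇒⊨ x = proj₂ (from (announced-domain ihφ φs w) (lift d⁺)) , from shift (from (ihψ φs⁺ w d⁺) x⁺)
      where
      x⁺ = from (pre-snoc φ) x
      d⁺ = Ww , PrefixProperties.pre-⊤ (W-theory Ww) φs⁺ x⁺

  Δ-rename : ∀ φs {m k A} → Γ (E (nom m ∧' pre φs (nom k ∧' A))) →
             Γ (E (nom k)) × Γ (E (nom k ∧' pre φs A))
  Δ-rename φs {m} {k} mkA =
    let (Pk , PA) = to Δm.pre-∧ mkA
        m∧k       = proj₂ (to (Δm.pre-nom k) Pk)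
    in E-∧ʳ m∧k , proj₁ (Δ-≐ m∧k _) PA
    where module Δm = PrefixProperties (Δ-theory (E-∧ˡ mkA)) φs

  truth-⟨-⟩ : ∀ {α ψ} → Truth α → Truth ψ → Truth (⟨- α ⟩ ψ)
  truth-⟨-⟩ {α} {ψ} ihα ihψ φs w d@(Ww , P⊤) = mk⇔ ⊨⇒∈ ∈⇒⊨
    where
    open PrefixProperties (W-theory Ww) φs

    ⊨⇒∈ : sat (derived φs) (Dom↑ φs) w (⟨- α ⟩ ψ) → w (pre φs (⟨- α ⟩ ψ))
    ⊨⇒∈ (t , lift dt@(Wt , P⊤t) , t≉w , sα , sψ) with 𝒲⇒Δ (proj₁ Wt)
    ... | k , Ek , t≐Δk = pre-mono (mixAx k α ψ) (from pre-∧ (PEkα , P!¬kψ))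
      where
      module Pt = PrefixProperties (W-theory Wt) φs
      d⁺ = lower (to (removed-domain φs t≐Δk Ek w) (lift d , λ (lift w≐t) → t≉w (lift (≐-sym w≐t))))
      P!¬kψ = to (pre-snoc (¬' nom k))
                 (to (ihψ _ w d⁺) (to (sat-resp-Dom ψ φs _ (removed-domain φs t≐Δk Ek) w) sψ))
      Pt-kα = from Pt.pre-∧ ( from (Pt.pre-nom k) (P⊤t , from (W-nom⇔≐Δ Wt Ek) t≐Δk)
                            , to (ihα φs t dt) sα)
      PEkα = from pre-E (P⊤ , W-E Ww (W-∈⇒E Wt Pt-kα))

    ∈⇒⊨ : w (pre φs (⟨- α ⟩ ψ)) → sat (derived φs) (Dom↑ φs) w (⟨- α ⟩ ψ)
    ∈⇒⊨ x = Δ k , dk , (λ (lift Δk≐w) → w≉Δk (lift (≐-sym Δk≐w))) , sα , sψ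
      where
      k = proj₁ (W-mixed Ww x)
      PEkα∧P!¬kψ = to pre-∧ (proj₂ (W-mixed Ww x))
      mkα = proj₂ (W-E-witness Ww (proj₂ (to pre-E (proj₁ PEkα∧P!¬kψ))))
      Ek : Γ (E (nom k))
      Ek = proj₁ (Δ-rename φs mkα)
      x⁺ : w (pre (φs ++ ¬' nom k ∷ []) ψ)
      x⁺ = from (pre-snoc (¬' nom k)) (proj₂ PEkα∧P!¬kψ)
      d⁺ : Dom (φs ++ ¬' nom k ∷ []) w
      d⁺ = Ww , PrefixProperties.pre-⊤ (W-theory Ww) (φs ++ ¬' nom k ∷ []) x⁺
      w≉Δk = proj₂ (from (removed-domain φs ≐-refl Ek w) (lift d⁺))
      sψ = from (sat-resp-Dom ψ φs _ (removed-domain φs ≐-refl Ek) w) (from (ihψ _ w d⁺) x⁺)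
      dk = proj₁ (Δ-sat ihα φs (proj₂ (Δ-rename φs mkα)))
      sα = proj₂ (Δ-sat ihα φs (proj₂ (Δ-rename φs mkα)))

  truth : ∀ ψ → Truth ψ
  truth (prop p)   φs w d@(Ww , _) = truth-atom φs w d (PrefixProperties.pre-prop (W-theory Ww) φs p)
  truth (nom k)    φs w d@(Ww , _) = truth-atom φs w d (PrefixProperties.pre-nom (W-theory Ww) φs k)
  truth ⊤'         φs w (_ , P⊤)   = mk⇔ (λ _ → P⊤) (λ _ → tt)
  truth (¬' ψ)     = truth-¬ (truth ψ)
  truth (ψ ∨' α)   = truth-∨ (truth ψ) (truth α)
  truth (◇ ψ)      = truth-◇ (truth ψ)
  truth (E ψ)      = truth-E (truth ψ)
  truth (⟨! φ ⟩ ψ) = truth-⟨!⟩ (truth φ) (truth ψ)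
  truth (⟨- α ⟩ ψ) = truth-⟨-⟩ (truth α) (truth ψ)

mainTheorem13 : (Γ : FSet) → MaximalConsistent Γ → Named Γ → Pasted ∇◇ Γ → Pasted ∇E Γ →
    Mixed Γ → EMixed Γ →
    (ψ : Form) (φs : List Form) (w : FSet) → Model.Dom (Henkin.derived Γ φs) w →
    (Henkin.derived Γ φs , w ⊨ ψ) ⇔ Henkin.Φ Γ φs w ψ
mainTheorem13 Γ Γ-mc named pasted◇ pastedE _ eMixed ψ =
  TruthLemma.truth Γ-mc named pasted◇ pastedE eMixed ψ
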